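{- Let $g\ge4$ be an even integer, let $p$ be a prime number with $p>g-1$, and let $n\ge1$ be an integer. If the multiplicative order $o_g(p)$ of $g$ modulo $p$ is even, then $p^n$ is complete. If $o_g(p)$ is odd and $g$ is a perfect square, then $p^n$ is complete.
   Context: Fix an even integer $g\ge4$. For an odd integer $m\ge1$, an extreme cycle for the digit set $\{0,m\}$ is a finite set of distinct integers $\{x_0,\dots,x_{r-1}\}$ together with digits $l_0,\dots,l_{r-1}\in\{0,m\}$ such that $x_{j+1}=(x_j+l_j)/g$ for $0\le j\le r-2$ and $x_0=(x_{r-1}+l_{r-1})/g$. The cycle $\{0\}$ (with digit $0$) is the trivial extreme cycle. The number $m$ is complete if the only extreme cycle for $\{0,m\}$ is the trivial one, and incomplete otherwise. For $m$ coprime to $g$, $o_g(m)$ denotes the order of $g$ in the multiplicative group $U(\mathbb{Z}_m)$. -}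

module Defs where

open import Data.Nat as ℕ using (ℕ; zero; suc; _^_; _∸_; _<_)
open import Data.Nat.Divisibility using (_∣_)
open import Data.Integer as ℤ using (ℤ; +_)
open import Data.Fin using (Fin; zero; suc; inject₁; fromℕ)
open import Data.Product using (_×_; ∃-syntax)
open import Data.Sum using (_⊎_)
open import Function.Definitions using (Injective)
open import Relation.Binary.PropositionalEquality using (_≡_)
open import Relation.Nullary using (¬_)

-- An extreme cycle for the digit set {0, m} in base g, of length r = suc k:
-- distinct integers x 0, …, x k and digits l j ∈ {0, m} with
-- x (j+1) = (x j + l j) / g  (exact division, i.e. g * x (j+1) = x j + l j)
-- for j < k, and x 0 = (x k + l k) / g.
record ExtremeCycle (g m k : ℕ) (x l : Fin (suc k) → ℤ) : Set where
  field
    distinct : Injective _≡_ _≡_ x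
    digits   : ∀ j → l j ≡ + 0 ⊎ l j ≡ + m
    step     : ∀ (j : Fin k) → (+ g) ℤ.* x (suc j) ≡ x (inject₁ j) ℤ.+ l (inject₁ j)
    close    : (+ g) ℤ.* x zero ≡ x (fromℕ k) ℤ.+ l (fromℕ k)

Complete : ℕ → ℕ → Set
Complete g m = ∀ (k : ℕ) (x l : Fin (suc k) → ℤ) →
  ExtremeCycle g m k x l → k ≡ 0 × x zero ≡ + 0

IsMultOrder : ℕ → ℕ → ℕ → Set
IsMultOrder g p o =
  0 < o × p ∣ (g ^ o ∸ 1) × (∀ j → 0 < j → j < o → ¬ (p ∣ (g ^ j ∸ 1)))

Even : ℕ → Set
Even n = 2 ∣ n

IsPerfectSquare : ℕ → Set
IsPerfectSquare g = ∃[ s ] g ≡ s ℕ.* s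

-- In an extreme cycle g·x_{j+1} = x_j + l_j all elements are nonnegative and
-- (g − 1)·x_max ≤ m, strictly when g − 1 ∤ m; walking T steps along the cycle gives
-- g^T·x_max ≡ x_j′ (mod m) for some cycle element x_j′. So if g^T ≡ c (mod m) with
-- c = −1 or c = ±√g, then c·x_max − x_j′ is a multiple of m of absolute value below m,
-- and it is nonzero unless x_max = 0, i.e. unless the cycle is trivial.
-- Such T exist for m = pⁿ: if o_g(p) = 2q then p ∣ g^q + 1 by minimality of the order,
-- and if o_g(p) is odd and g = s² then p ∣ s^o ∓ 1; as p is odd, raising to the power
-- p^(n−1) lifts these congruences from p to pⁿ, and s·s^(o·p^(n−1)) is a power of g.

module Submission where

open import Defs
open import Data.Nat using (ℕ; _^_; _∸_; _<_; _≤_)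
open import Data.Nat.Divisibility using (_∣_)
open import Data.Nat.Primality using (Prime)
open import Data.Product using (_×_)
open import Relation.Nullary using (¬_)

import Data.Nat as ℕ
open import Data.Nat using (zero; suc; z≤n; s≤s; z<s; NonZero)
import Data.Nat.Properties as ℕₚ
open import Data.Nat.Divisibility
  using (divides; _∣0; ∣1⇒≡1; >⇒∤; m∣m*n; ∣m∣n⇒∣m+n)
open import Data.Nat.Primality using (euclidsLemma; prime⇒irreducible; prime?)
open import Data.Nat.Coprimality using (coprime-divisor; prime⇒coprime)
  renaming (sym to coprime-sym)
open import Data.Nat.Tactic.RingSolver using () renaming (solve-∀ to solve-ℕ)
import Data.Integer as ℤ
open import Data.Integer
  using (ℤ; +_; -_; 0ℤ; 1ℤ; -1ℤ; _+_; _-_; _*_)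
  renaming (_≤_ to _≤ᶻ_; _^_ to _^ᶻ_)
import Data.Integer.Properties as ℤₚ
open import Data.Integer.Divisibility.Signed as ℤ∣
  using (divides) renaming (_∣_ to _∣ᶻ_)
open import Data.Integer.Tactic.RingSolver using (solve-∀)
open import Data.Fin using (Fin; zero; suc; inject₁; fromℕ; toℕ)
open import Data.Fin.Properties using (toℕ-fromℕ)
open import Data.List using (allFin)
import Data.List.Relation.Unary.All as All
open import Data.List.Membership.Propositional.Properties using (∈-allFin)
open import Data.List.Extrema ℤₚ.≤-totalOrder
  using (argmin; argmax; f[argmin]≤f[xs]; f[xs]≤f[argmax])
open import Data.Product using (_,_; ∃-syntax)
open import Data.Sum using (_⊎_; inj₁; inj₂; [_,_]′)
open import Data.Empty using (⊥-elim)
open import Function using (_∘_; id)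
open import Relation.Nullary.Decidable using (from-yes)
open import Relation.Binary.PropositionalEquality

even-2+ : ∀ {n} → Even n → Even (2 ℕ.+ n)
even-2+ = ∣m∣n⇒∣m+n (divides 1 refl)

odd-* : ∀ {m n} → ¬ Even m → ¬ Even n → ¬ Even (m ℕ.* n)
odd-* {m} {n} 2∤m 2∤n 2∣mn =
  [ 2∤m , 2∤n ]′ (euclidsLemma m n (from-yes (prime? 2)) 2∣mn)

odd-^ : ∀ {m} → ¬ Even m → ∀ n → ¬ Even (m ^ n)
odd-^ _   zero    2∣1 with () ← ∣1⇒≡1 2∣1
odd-^ 2∤m (suc n) = odd-* 2∤m (odd-^ 2∤m n)

prime⇒odd : ∀ {p} → Prime p → 2 < p → ¬ Even p
prime⇒odd pr 2<p 2∣p with prime⇒irreducible pr 2∣p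
... | inj₁ ()
... | inj₂ refl = ℕₚ.<-irrefl refl 2<p

-- Lifting congruences to prime powers

pos-^ : ∀ a n → + (a ^ n) ≡ (+ a) ^ᶻ n
pos-^ a zero    = refl
pos-^ a (suc n) = trans (ℤₚ.pos-* a (a ^ n)) (cong (+ a *_) (pos-^ a n))

Sign : ℤ → Set
Sign ε = ε ≡ 1ℤ ⊎ ε ≡ -1ℤ

sign-^-odd : ∀ {ε} → Sign ε → ∀ n → ¬ Even n → ε ^ᶻ n ≡ ε
sign-^-odd _        zero          2∤0 = ⊥-elim (2∤0 (2 ∣0))
sign-^-odd _        (suc zero)    _   = ℤₚ.*-identityʳ _
sign-^-odd {ε} sign (suc (suc n)) 2∤n+2 = begin
  ε * (ε * ε ^ᶻ n) ≡⟨ ℤₚ.*-assoc ε ε (ε ^ᶻ n) ⟨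
  (ε * ε) * ε ^ᶻ n ≡⟨ cong₂ _*_ (ε*ε≡1 sign) (sign-^-odd sign n (2∤n+2 ∘ even-2+)) ⟩
  1ℤ * ε           ≡⟨ ℤₚ.*-identityˡ ε ⟩
  ε                ∎
  where
  open ≡-Reasoning
  ε*ε≡1 : ∀ {ε} → Sign ε → ε * ε ≡ 1ℤ
  ε*ε≡1 (inj₁ refl) = refl
  ε*ε≡1 (inj₂ refl) = refl

i*i^t≡[i*i]^T : ∀ (i : ℤ) t → ¬ Even t → ∃[ T ] i * i ^ᶻ t ≡ (i * i) ^ᶻ T
i*i^t≡[i*i]^T i zero          2∤0   = ⊥-elim (2∤0 (2 ∣0))
i*i^t≡[i*i]^T i (suc zero)    _     = 1 , sym (ℤₚ.*-assoc i i 1ℤ)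
i*i^t≡[i*i]^T i (suc (suc t)) 2∤t+2 with i*i^t≡[i*i]^T i t (2∤t+2 ∘ even-2+)
... | T , eq = suc T , trans (regroup i (i ^ᶻ t)) (cong ((i * i) *_) eq)
  where
  regroup : ∀ (i P : ℤ) → i * (i * (i * P)) ≡ (i * i) * (i * P)
  regroup = solve-∀

binomial-head : ∀ j (E D : ℤ) →
  ∃[ R ] (E + D) ^ᶻ suc j ≡ E ^ᶻ suc j + E ^ᶻ j * (D * + suc j) + D * D * R
binomial-head zero    E D = 0ℤ , linear E D
  where
  linear : ∀ (E D : ℤ) → (E + D) * 1ℤ ≡ E * 1ℤ + 1ℤ * (D * 1ℤ) + D * D * 0ℤ
  linear = solve-∀
binomial-head (suc j) E D with binomial-head j E D
... | R , expand = E * R + E ^ᶻ j * + suc j + D * R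
                 , trans (cong ((E + D) *_) expand) (multiply E D (E ^ᶻ j) (+ suc j) R)
  where
  multiply : ∀ (E D P n R : ℤ) →
    (E + D) * (E * P + P * (D * n) + D * D * R)
      ≡ E * (E * P) + (E * P) * (D * (1ℤ + n)) + D * D * (E * R + P * n + D * R)
  multiply = solve-∀

-- p ∣ q makes q·p divide both the linear and the quadratic term of the expansion.
∣-pow-lift : ∀ p {q} {A E : ℤ} → + p ∣ᶻ + q → + q ∣ᶻ A - E → + (q ℕ.* p) ∣ᶻ A ^ᶻ p - E ^ᶻ p
∣-pow-lift zero    _ _ = divides 0ℤ refl
∣-pow-lift (suc j) {q} {A} {E} p∣q q∣D with binomial-head j E (A - E)
... | R , expand = subst (+ (q ℕ.* suc j) ∣ᶻ_) (sym difference)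
    (ℤ∣.∣m∣n⇒∣m+n (ℤ∣.∣n⇒∣m*n (E ^ᶻ j) qp∣Dp) (ℤ∣.∣m⇒∣m*n R qp∣DD))
  where
  open ≡-Reasoning
  D = A - E
  qp∣Dp : + (q ℕ.* suc j) ∣ᶻ D * + suc j
  qp∣Dp = subst (_∣ᶻ D * + suc j) (sym (ℤₚ.pos-* q (suc j))) (ℤ∣.*-monoˡ-∣ (+ suc j) q∣D)
  qp∣DD : + (q ℕ.* suc j) ∣ᶻ D * D
  qp∣DD = ℤ∣.∣-trans qp∣Dp (ℤ∣.*-monoʳ-∣ D (ℤ∣.∣-trans p∣q q∣D))
  split : ∀ (A E : ℤ) → A ≡ E + (A - E)
  split = solve-∀
  cancel : ∀ (X Y Z : ℤ) → X + Y + Z - X ≡ Y + Z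
  cancel = solve-∀
  difference : A ^ᶻ suc j - E ^ᶻ suc j ≡ E ^ᶻ j * (D * + suc j) + D * D * R
  difference = begin
    A ^ᶻ suc j - E ^ᶻ suc j
      ≡⟨ cong (λ a → a ^ᶻ suc j - E ^ᶻ suc j) (split A E) ⟩
    (E + D) ^ᶻ suc j - E ^ᶻ suc j
      ≡⟨ cong (_- E ^ᶻ suc j) expand ⟩
    E ^ᶻ suc j + E ^ᶻ j * (D * + suc j) + D * D * R - E ^ᶻ suc j
      ≡⟨ cancel (E ^ᶻ suc j) (E ^ᶻ j * (D * + suc j)) (D * D * R) ⟩
    E ^ᶻ j * (D * + suc j) + D * D * R ∎

∣-pow-lift-iter : ∀ p n {A E : ℤ} → + p ∣ᶻ A - E →
  + (p ^ suc n) ∣ᶻ A ^ᶻ (p ^ n) - E ^ᶻ (p ^ n)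
∣-pow-lift-iter p zero {A} {E} p∣A-E =
  subst₂ _∣ᶻ_ (cong +_ (sym (ℕₚ.*-identityʳ p)))
    (sym (cong₂ _-_ (ℤₚ.^-identityʳ A) (ℤₚ.^-identityʳ E))) p∣A-E
∣-pow-lift-iter p (suc n) {A} {E} p∣A-E =
  subst₂ _∣ᶻ_ (cong +_ (ℕₚ.*-comm (p ^ suc n) p)) (cong₂ _-_ (power A) (power E))
    (∣-pow-lift p (ℤ∣.∣ᵤ⇒∣ (m∣m*n (p ^ n))) (∣-pow-lift-iter p n p∣A-E))
  where
  power : ∀ B → (B ^ᶻ (p ^ n)) ^ᶻ p ≡ B ^ᶻ (p ^ suc n)
  power B = trans (ℤₚ.^-*-assoc B (p ^ n) p) (cong (B ^ᶻ_) (ℕₚ.*-comm (p ^ n) p))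

∣-sign-lift : ∀ {p ε} {A : ℤ} → ¬ Even p → Sign ε → ∀ n → + p ∣ᶻ A - ε →
  + (p ^ suc n) ∣ᶻ A ^ᶻ (p ^ n) - ε
∣-sign-lift {p} {ε} {A} 2∤p sign n p∣A-ε =
  subst (λ e → + (p ^ suc n) ∣ᶻ A ^ᶻ (p ^ n) - e) (sign-^-odd sign (p ^ n) (odd-^ 2∤p n))
    (∣-pow-lift-iter p n p∣A-ε)

-- Square roots of 1 modulo a prime, and powers of g

u*u∸1≡[u∸1]*[u+1] : ∀ u → u ℕ.* u ∸ 1 ≡ (u ∸ 1) ℕ.* (u ℕ.+ 1)
u*u∸1≡[u∸1]*[u+1] zero    = refl
u*u∸1≡[u∸1]*[u+1] (suc v) = factor v
  where
  factor : ∀ v → v ℕ.+ v ℕ.* suc v ≡ v ℕ.* (suc v ℕ.+ 1)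
  factor = solve-ℕ

prime-∣-square∸1 : ∀ {p u} → Prime p → p ∣ u ℕ.* u ∸ 1 → p ∣ u ∸ 1 ⊎ p ∣ u ℕ.+ 1
prime-∣-square∸1 {p} {u} pr p∣ =
  euclidsLemma (u ∸ 1) (u ℕ.+ 1) pr (subst (p ∣_) (u*u∸1≡[u∸1]*[u+1] u) p∣)

∣u∸1⇒∣ᶻu-1 : ∀ {p u} → 0 < u → p ∣ u ∸ 1 → + p ∣ᶻ + u - 1ℤ
∣u∸1⇒∣ᶻu-1 {p} {u} 0<u p∣ =
  ℤ∣.∣ᵤ⇒∣ (subst (λ i → p ∣ ℤ.∣ i ∣) (sym (trans (ℤₚ.m-n≡m⊖n u 1) (ℤₚ.⊖-≥ 0<u))) p∣)

∣u+1⇒∣ᶻu+1 : ∀ {p u} → p ∣ u ℕ.+ 1 → + p ∣ᶻ + u - -1ℤ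
∣u+1⇒∣ᶻu+1 = ℤ∣.∣ᵤ⇒∣

prime-∣-square∸1⇒sign : ∀ {p u} → Prime p → 0 < u → p ∣ u ℕ.* u ∸ 1 →
  ∃[ ε ] Sign ε × + p ∣ᶻ + u - ε
prime-∣-square∸1⇒sign pr 0<u p∣ with prime-∣-square∸1 pr p∣
... | inj₁ p∣u∸1 = 1ℤ  , inj₁ refl , ∣u∸1⇒∣ᶻu-1 0<u p∣u∸1
... | inj₂ p∣u+1 = -1ℤ , inj₂ refl , ∣u+1⇒∣ᶻu+1 p∣u+1

^-distribʳ-* : ∀ a b n → (a ℕ.* b) ^ n ≡ a ^ n ℕ.* b ^ n
^-distribʳ-* a b zero    = refl
^-distribʳ-* a b (suc n) = trans (cong (a ℕ.* b ℕ.*_) (^-distribʳ-* a b n))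
                                 (ℕₚ.[m*n]*[o*p]≡[m*o]*[n*p] a b (a ^ n) (b ^ n))

even-order⇒∣pow+1 : ∀ {g p o} → Prime p → 2 < p → IsMultOrder g p o → Even o →
  ∀ n → ∃[ T ] + (p ^ suc n) ∣ᶻ (+ g) ^ᶻ T - -1ℤ
even-order⇒∣pow+1 {g} {p} pr 2<p (0<o , p∣g^o∸1 , minimal) (divides q refl) n =
  q ℕ.* p ^ n , subst (λ B → + (p ^ suc n) ∣ᶻ B - -1ℤ) power
    (∣-sign-lift (prime⇒odd pr 2<p) (inj₂ refl) n (∣u+1⇒∣ᶻu+1 p∣u+1))
  where
  instance
    q≢0 : NonZero q
    q≢0 = ℕₚ.m*n≢0⇒m≢0 q {{ℕ.>-nonZero 0<o}}
  u = g ^ q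
  g^[q*2]≡u*u : g ^ (q ℕ.* 2) ≡ u ℕ.* u
  g^[q*2]≡u*u = trans (sym (ℕₚ.^-*-assoc g q 2)) (cong (u ℕ.*_) (ℕₚ.*-identityʳ u))
  p∣u+1 : p ∣ u ℕ.+ 1
  p∣u+1 = [ ⊥-elim ∘ minimal q (ℕ.>-nonZero⁻¹ q) (ℕₚ.m<m*n q 2 (s≤s (s≤s z≤n))) , id ]′
    (prime-∣-square∸1 pr (subst (λ v → p ∣ v ∸ 1) g^[q*2]≡u*u p∣g^o∸1))
  power : (+ u) ^ᶻ (p ^ n) ≡ (+ g) ^ᶻ (q ℕ.* p ^ n)
  power = trans (cong (_^ᶻ (p ^ n)) (pos-^ g q)) (ℤₚ.^-*-assoc (+ g) q (p ^ n))

odd-order⇒∣pow∓root : ∀ {g p o s} → Prime p → 2 < p → IsMultOrder g p o → ¬ Even o →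
  0 < s → g ≡ s ℕ.* s → ∀ n → ∃[ T ] ∃[ ε ] Sign ε × + (p ^ suc n) ∣ᶻ (+ g) ^ᶻ T - ε * + s
odd-order⇒∣pow∓root {p = p} {o} {s} pr 2<p (_ , p∣g^o∸1 , _) 2∤o 0<s refl n
  with prime-∣-square∸1⇒sign pr (ℕₚ.m^n>0 s {{ℕ.>-nonZero 0<s}} o)
         (subst (λ v → p ∣ v ∸ 1) (^-distribʳ-* s s o) p∣g^o∸1)
     | i*i^t≡[i*i]^T (+ s) (o ℕ.* p ^ n) (odd-* 2∤o (odd-^ (prime⇒odd pr 2<p) n))
... | ε , sign , p∣u-ε | T , s·s^t≡[s·s]^T =
  T , ε , sign , subst (+ (p ^ suc n) ∣ᶻ_) multiply
                   (ℤ∣.∣n⇒∣m*n (+ s) (∣-sign-lift (prime⇒odd pr 2<p) sign n p∣u-ε))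
  where
  open ≡-Reasoning
  U = (+ (s ^ o)) ^ᶻ (p ^ n)
  distribute : ∀ (S B ε : ℤ) → S * (B - ε) ≡ S * B - ε * S
  distribute = solve-∀
  multiply : + s * (U - ε) ≡ (+ (s ℕ.* s)) ^ᶻ T - ε * + s
  multiply = begin
    + s * (U - ε)                    ≡⟨ distribute (+ s) U ε ⟩
    + s * U - ε * + s                ≡⟨ cong (λ B → + s * B - ε * + s) power ⟩
    + s * (+ s) ^ᶻ (o ℕ.* p ^ n) - ε * + s ≡⟨ cong (_- ε * + s) s·s^t≡[s·s]^T ⟩
    (+ s * + s) ^ᶻ T - ε * + s       ≡⟨ cong (λ G → G ^ᶻ T - ε * + s) (ℤₚ.pos-* s s) ⟨
    (+ (s ℕ.* s)) ^ᶻ T - ε * + s     ∎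
    where
    power : U ≡ (+ s) ^ᶻ (o ℕ.* p ^ n)
    power = trans (cong (_^ᶻ (p ^ n)) (pos-^ s o)) (ℤₚ.^-*-assoc (+ s) o (p ^ n))

-- Extreme cycles

*-cancelˡ-nonNeg : ∀ {h} {i : ℤ} → 0 < h → 0ℤ ≤ᶻ + h * i → 0ℤ ≤ᶻ i
*-cancelˡ-nonNeg {suc h} {i} _ 0≤hi =
  ℤₚ.*-cancelˡ-≤-pos 0ℤ i (+ suc h) (subst (_≤ᶻ + suc h * i) (sym (ℤₚ.*-zeroʳ (+ suc h))) 0≤hi)

module ExtremeCycleProperties {h m k : ℕ} {x l : Fin (suc k) → ℤ}
                              (C : ExtremeCycle (suc h) m k x l) where
  open ExtremeCycle C

  pred : Fin (suc k) → Fin (suc k)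
  pred zero    = fromℕ k
  pred (suc j) = inject₁ j

  step-pred : ∀ j → + suc h * x j ≡ x (pred j) + l (pred j)
  step-pred zero    = close
  step-pred (suc j) = step j

  by-digit : (P : ℤ → Set) → P 0ℤ → P (+ m) → ∀ j → P (l j)
  by-digit P p0 pm j = [ (λ e → subst P (sym e) p0) , (λ e → subst P (sym e) pm) ]′ (digits j)

  m∣digit : ∀ j → + m ∣ᶻ l j
  m∣digit = by-digit (+ m ∣ᶻ_) (divides 0ℤ refl) ℤ∣.∣-refl

  0≤digit : ∀ j → 0ℤ ≤ᶻ l j
  0≤digit = by-digit (0ℤ ≤ᶻ_) ℤₚ.≤-refl (ℤ.+≤+ z≤n)

  digit≤m : ∀ j → l j ≤ᶻ + m
  digit≤m = by-digit (_≤ᶻ + m) (ℤ.+≤+ z≤n) ℤₚ.≤-refl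

  orbit : ∀ t j → ∃[ j′ ] + m ∣ᶻ (+ suc h) ^ᶻ t * x j - x j′
  orbit zero    j = j , divides 0ℤ (no-shift (x j) (+ m))
    where
    no-shift : ∀ (X M : ℤ) → 1ℤ * X - X ≡ 0ℤ * M
    no-shift = solve-∀
  orbit (suc t) j with orbit t j
  ... | j′ , m∣ = pred j′ , subst (+ m ∣ᶻ_) (sym shift)
        (ℤ∣.∣m∣n⇒∣m+n (ℤ∣.∣n⇒∣m*n G m∣) (m∣digit (pred j′)))
    where
    open ≡-Reasoning
    G = + suc h
    regroup : ∀ (G P X Y Z : ℤ) → G * P * X - Z ≡ G * (P * X - Y) + (G * Y - Z)
    regroup = solve-∀
    cancel : ∀ (Y L : ℤ) → Y + L - Y ≡ L
    cancel = solve-∀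
    shift : G * G ^ᶻ t * x j - x (pred j′) ≡ G * (G ^ᶻ t * x j - x j′) + l (pred j′)
    shift = begin
      G * G ^ᶻ t * x j - x (pred j′)
        ≡⟨ regroup G (G ^ᶻ t) (x j) (x j′) (x (pred j′)) ⟩
      G * (G ^ᶻ t * x j - x j′) + (G * x j′ - x (pred j′))
        ≡⟨ cong (λ y → G * (G ^ᶻ t * x j - x j′) + (y - x (pred j′))) (step-pred j′) ⟩
      G * (G ^ᶻ t * x j - x j′) + (x (pred j′) + l (pred j′) - x (pred j′))
        ≡⟨ cong (λ y → G * (G ^ᶻ t * x j - x j′) + y) (cancel (x (pred j′)) (l (pred j′))) ⟩
      G * (G ^ᶻ t * x j - x j′) + l (pred j′) ∎

  excess : ∀ j → + h * x j ≡ (x (pred j) - x j) + l (pred j)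
  excess j = begin
    + h * x j                     ≡⟨ peel (+ h) (x j) ⟩
    (1ℤ + + h) * x j - x j        ≡⟨ cong (_- x j) (step-pred j) ⟩
    x (pred j) + l (pred j) - x j ≡⟨ swap (x (pred j)) (l (pred j)) (x j) ⟩
    (x (pred j) - x j) + l (pred j) ∎
    where
    open ≡-Reasoning
    peel : ∀ (H X : ℤ) → H * X ≡ (1ℤ + H) * X - X
    peel = solve-∀
    swap : ∀ (Y L X : ℤ) → Y + L - X ≡ (Y - X) + L
    swap = solve-∀

  jmin jmax : Fin (suc k)
  jmin = argmin x zero (allFin (suc k))
  jmax = argmax x zero (allFin (suc k))

  x[jmin]≤x : ∀ i → x jmin ≤ᶻ x i
  x[jmin]≤x i = All.lookup (f[argmin]≤f[xs] {f = x} zero (allFin (suc k))) (∈-allFin i)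

  x≤x[jmax] : ∀ i → x i ≤ᶻ x jmax
  x≤x[jmax] i = All.lookup (f[xs]≤f[argmax] {f = x} zero (allFin (suc k))) (∈-allFin i)

  0≤x : 0 < h → ∀ i → 0ℤ ≤ᶻ x i
  0≤x 0<h i = ℤₚ.≤-trans (*-cancelˡ-nonNeg 0<h 0≤h·x[jmin]) (x[jmin]≤x i)
    where
    0≤h·x[jmin] : 0ℤ ≤ᶻ + h * x jmin
    0≤h·x[jmin] = subst (0ℤ ≤ᶻ_) (sym (excess jmin))
      (ℤₚ.+-mono-≤ (ℤₚ.i≤j⇒0≤j-i (x[jmin]≤x (pred jmin))) (0≤digit (pred jmin)))

  h·x[jmax]≤m : + h * x jmax ≤ᶻ + m
  h·x[jmax]≤m = subst (_≤ᶻ + m) (sym (excess jmax))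
    (ℤₚ.+-mono-≤ (ℤₚ.i≤j⇒i-j≤0 (x≤x[jmax] (pred jmax))) (digit≤m (pred jmax)))

  zero-cycle : (∀ i → x i ≡ 0ℤ) → k ≡ 0 × x zero ≡ + 0
  zero-cycle x≡0 =
    sym (trans (cong toℕ (distinct (trans (x≡0 zero) (sym (x≡0 (fromℕ k)))))) (toℕ-fromℕ k))
    , x≡0 zero

∣-replace-factor : ∀ {d A c X Y : ℤ} → d ∣ᶻ A * X - Y → d ∣ᶻ A - c → d ∣ᶻ c * X - Y
∣-replace-factor {d} {A} {c} {X} {Y} d∣AX-Y d∣A-c =
  subst (d ∣ᶻ_) (difference A c X Y) (ℤ∣.∣m∣n⇒∣m-n d∣AX-Y (ℤ∣.∣m⇒∣m*n X d∣A-c))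
  where
  difference : ∀ (A c X Y : ℤ) → (A * X - Y) - (A - c) * X ≡ c * X - Y
  difference = solve-∀

-- Used with a = x_max and b another cycle element, where (g − 1)·x_max < m.
NoSmallMultiple : ℕ → ℕ → ℤ → Set
NoSmallMultiple h m c = ∀ a b → 0 < a → b ≤ a → h ℕ.* a < m → ¬ (+ m ∣ᶻ c * + a - + b)

complete-of-residue : ∀ {h m} T c → 0 < h → ¬ h ∣ m → + m ∣ᶻ (+ suc h) ^ᶻ T - c →
  NoSmallMultiple h m c → Complete (suc h) m
complete-of-residue {h} {m} T c 0<h h∤m m∣G^T-c no-small k x l C =
  zero-cycle λ i → ℤₚ.≤-antisym (ℤₚ.≤-trans (x≤x[jmax] i) (ℤₚ.≤-reflexive x[jmax]≡0)) (0≤x 0<h i)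
  where
  open ExtremeCycleProperties C
  a : Fin (suc k) → ℕ
  a i = ℤ.∣ x i ∣
  x≡+a : ∀ i → x i ≡ + a i
  x≡+a i = sym (ℤₚ.0≤i⇒+∣i∣≡i (0≤x 0<h i))
  a≤a[jmax] : ∀ i → a i ≤ a jmax
  a≤a[jmax] i = ℤₚ.drop‿+≤+ (subst₂ _≤ᶻ_ (x≡+a i) (x≡+a jmax) (x≤x[jmax] i))
  h·a[jmax]<m : h ℕ.* a jmax < m
  h·a[jmax]<m = ℕₚ.≤∧≢⇒<
    (ℤₚ.drop‿+≤+ (subst (_≤ᶻ + m) (trans (cong (+ h *_) (x≡+a jmax)) (sym (ℤₚ.pos-* h (a jmax))))
                                   h·x[jmax]≤m))
    (λ e → h∤m (divides (a jmax) (trans (sym e) (ℕₚ.*-comm h (a jmax)))))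
  a[jmax]≯0 : ¬ (0 < a jmax)
  a[jmax]≯0 0<a with orbit T jmax
  ... | j′ , m∣ = no-small (a jmax) (a j′) 0<a (a≤a[jmax] j′) h·a[jmax]<m
    (subst₂ (λ X Y → + m ∣ᶻ c * X - Y) (x≡+a jmax) (x≡+a j′)
      (∣-replace-factor {A = (+ suc h) ^ᶻ T} {c} m∣ m∣G^T-c))
  x[jmax]≡0 : x jmax ≡ 0ℤ
  x[jmax]≡0 = trans (x≡+a jmax) (cong +_ (ℕₚ.n≤0⇒n≡0 (ℕₚ.≮⇒≥ a[jmax]≯0)))

∣-neg⇒∣ : ∀ {m n} → + m ∣ᶻ - + n → m ∣ n
∣-neg⇒∣ {m} {n} m∣ = subst (m ∣_) (ℤₚ.∣-i∣≡∣i∣ (+ n)) (ℤ∣.∣⇒∣ᵤ m∣)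

noSmallMultiple-minus-one : ∀ {h m} → 2 ≤ h → NoSmallMultiple h m -1ℤ
noSmallMultiple-minus-one {h} {m} 2≤h a b 0<a b≤a h·a<m m∣ =
  >⇒∤ {{ℕ.>-nonZero (ℕₚ.<-≤-trans 0<a (ℕₚ.m≤m+n a b))}} a+b<m
    (∣-neg⇒∣ (subst (+ m ∣ᶻ_) (negate (+ a) (+ b)) m∣))
  where
  open ℕₚ.≤-Reasoning
  negate : ∀ (A B : ℤ) → -1ℤ * A - B ≡ - (A + B)
  negate = solve-∀
  a+b<m : a ℕ.+ b < m
  a+b<m = begin-strict
    a ℕ.+ b         ≤⟨ ℕₚ.+-monoʳ-≤ a b≤a ⟩
    a ℕ.+ a         ≡⟨ cong (a ℕ.+_) (ℕₚ.+-identityʳ a) ⟨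
    2 ℕ.* a         ≤⟨ ℕₚ.*-monoˡ-≤ a 2≤h ⟩
    h ℕ.* a         <⟨ h·a<m ⟩
    m               ∎

noSmallMultiple-±root : ∀ {h m s ε} → 2 ≤ s → suc s ≤ h → Sign ε →
  NoSmallMultiple h m (ε * + s)
noSmallMultiple-±root {h} {m} {s} 2≤s s<h (inj₁ refl) a b 0<a b≤a h·a<m m∣ =
  >⇒∤ {{ℕ.>-nonZero (ℕₚ.m<n⇒0<n∸m b<s·a)}} s·a∸b<m
    (subst (m ∣_) (cong ℤ.∣_∣ positive) (ℤ∣.∣⇒∣ᵤ m∣))
  where
  unit : ∀ (S A B : ℤ) → (1ℤ * S) * A - B ≡ S * A - B
  unit = solve-∀
  b<s·a : b < s ℕ.* a
  b<s·a = ℕₚ.≤-<-trans b≤a (subst (a <_) (ℕₚ.*-comm a s) (ℕₚ.m<m*n a s {{ℕ.>-nonZero 0<a}} 2≤s))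
  positive : (1ℤ * + s) * + a - + b ≡ + (s ℕ.* a ∸ b)
  positive = begin
    (1ℤ * + s) * + a - + b ≡⟨ unit (+ s) (+ a) (+ b) ⟩
    + s * + a - + b        ≡⟨ cong (_- + b) (ℤₚ.pos-* s a) ⟨
    + (s ℕ.* a) - + b      ≡⟨ ℤₚ.m-n≡m⊖n (s ℕ.* a) b ⟩
    (s ℕ.* a) ℤ.⊖ b        ≡⟨ ℤₚ.⊖-≥ (ℕₚ.<⇒≤ b<s·a) ⟩
    + (s ℕ.* a ∸ b)        ∎
    where open ≡-Reasoning
  s·a∸b<m : s ℕ.* a ∸ b < m
  s·a∸b<m = begin-strict
    s ℕ.* a ∸ b ≤⟨ ℕₚ.m∸n≤m (s ℕ.* a) b ⟩
    s ℕ.* a     ≤⟨ ℕₚ.*-monoˡ-≤ a (ℕₚ.≤-trans (ℕₚ.n≤1+n s) s<h) ⟩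
    h ℕ.* a     <⟨ h·a<m ⟩
    m           ∎
    where open ℕₚ.≤-Reasoning
noSmallMultiple-±root {h} {m} {s} 2≤s s<h (inj₂ refl) a b 0<a b≤a h·a<m m∣ =
  >⇒∤ {{ℕ.>-nonZero (ℕₚ.<-≤-trans 0<a a≤s·a+b)}} s·a+b<m
    (∣-neg⇒∣ (subst (+ m ∣ᶻ_) negative m∣))
  where
  negate : ∀ (S A B : ℤ) → (-1ℤ * S) * A - B ≡ - (S * A + B)
  negate = solve-∀
  negative : (-1ℤ * + s) * + a - + b ≡ - + (s ℕ.* a ℕ.+ b)
  negative = trans (negate (+ s) (+ a) (+ b)) (cong (λ i → - (i + + b)) (sym (ℤₚ.pos-* s a)))
  a≤s·a+b : a ≤ s ℕ.* a ℕ.+ b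
  a≤s·a+b = ℕₚ.≤-trans (ℕₚ.m≤n*m a s {{ℕ.>-nonZero (ℕₚ.<-≤-trans z<s 2≤s)}}) (ℕₚ.m≤m+n _ b)
  s·a+b<m : s ℕ.* a ℕ.+ b < m
  s·a+b<m = begin-strict
    s ℕ.* a ℕ.+ b ≤⟨ ℕₚ.+-monoʳ-≤ (s ℕ.* a) b≤a ⟩
    s ℕ.* a ℕ.+ a ≡⟨ ℕₚ.+-comm (s ℕ.* a) a ⟩
    suc s ℕ.* a   ≤⟨ ℕₚ.*-monoˡ-≤ a s<h ⟩
    h ℕ.* a       <⟨ h·a<m ⟩
    m             ∎
    where open ℕₚ.≤-Reasoning

1<d<p⇒d∤p^n : ∀ {d p} → Prime p → 1 < d → d < p → ∀ n → ¬ d ∣ p ^ n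
1<d<p⇒d∤p^n pr 1<d d<p zero    d∣1   = ℕₚ.<⇒≢ 1<d (sym (∣1⇒≡1 d∣1))
1<d<p⇒d∤p^n pr 1<d d<p (suc n) d∣p^n =
  1<d<p⇒d∤p^n pr 1<d d<p n
    (coprime-divisor (coprime-sym (prime⇒coprime pr {{ℕ.>-nonZero (ℕₚ.<-trans z<s 1<d)}} d<p))
      d∣p^n)

square-root-bounds : ∀ {h s} → 0 < h → suc h ≡ s ℕ.* s → 2 ≤ s × suc s ≤ h
square-root-bounds {s = suc zero} () refl
square-root-bounds {h} {suc (suc t)} _ eq =
  s≤s (s≤s z≤n) , subst (3 ℕ.+ t ≤_) (sym h≡[t+3][t+1]) (ℕₚ.m≤m*n (3 ℕ.+ t) (suc t))
  where
  expand : ∀ t → suc (suc t) ℕ.* suc (suc t) ≡ suc (suc (suc (suc t)) ℕ.* suc t)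
  expand = solve-ℕ
  h≡[t+3][t+1] : h ≡ suc (suc (suc t)) ℕ.* suc t
  h≡[t+3][t+1] = ℕₚ.suc-injective (trans eq (expand t))

theorem2p18 : ∀ (g : ℕ) → 4 ≤ g → 2 ∣ g →
    ∀ (p : ℕ) → Prime p → g ∸ 1 < p →
    ∀ (n : ℕ) → 1 ≤ n →
    ∀ (o : ℕ) → IsMultOrder g p o →
    (Even o → Complete g (p ^ n)) ×
    (¬ Even o → IsPerfectSquare g → Complete g (p ^ n))
theorem2p18 zero    ()
theorem2p18 (suc h) (s≤s 3≤h) _ p pr h<p zero    ()
theorem2p18 (suc h) (s≤s 3≤h) _ p pr h<p (suc n) _  o order = even-case , square-case
  where
  2≤h : 2 ≤ h
  2≤h = ℕₚ.≤-trans (ℕₚ.n≤1+n 2) 3≤h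
  0<h : 0 < h
  0<h = ℕₚ.<-trans z<s 2≤h
  2<p : 2 < p
  2<p = ℕₚ.<-≤-trans 3≤h (ℕₚ.<⇒≤ h<p)
  h∤p^n : ¬ h ∣ p ^ suc n
  h∤p^n = 1<d<p⇒d∤p^n pr 2≤h h<p (suc n)
  even-case : Even o → Complete (suc h) (p ^ suc n)
  even-case even =
    let T , p^n∣g^T+1 = even-order⇒∣pow+1 pr 2<p order even n
    in complete-of-residue T -1ℤ 0<h h∤p^n p^n∣g^T+1 (noSmallMultiple-minus-one 2≤h)
  square-case : ¬ Even o → IsPerfectSquare (suc h) → Complete (suc h) (p ^ suc n)
  square-case odd (s , g≡s·s) =
    let 2≤s , s<h = square-root-bounds {s = s} 0<h g≡s·s
        T , ε , sign , p^n∣g^T∓s =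
          odd-order⇒∣pow∓root {s = s} pr 2<p order odd (ℕₚ.<-trans z<s 2≤s) g≡s·s n
    in complete-of-residue T (ε * + s) 0<h h∤p^n p^n∣g^T∓s
         (noSmallMultiple-±root 2≤s s<h sign)
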